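{- Let $G$ be a connected finite simple graph of order $n\geq 2$, let $I$ be an independent set in $G$, and let $M$ be a matching in $\overline{G\setminus I}$, the complement of the subgraph of $G$ induced by $V(G)\setminus I$. Then $\chi_{md}(G)\leq n-|M|-|I|+1$, and the bound is sharp (e.g. equality holds for $G=K_n$).
   Context: For a vertex $v$, $N[v]=N(v)\cup\{v\}$; $v$ dominates exactly the vertices of $N[v]$. A majority dominator coloring of $G$ is a proper vertex coloring such that for every vertex $v$ there is a color class $C$ with $|N[v]\cap C|\geq |C|/2$. $\chi_{md}(G)$ is the minimum number of color classes in a majority dominator coloring of $G$. $\overline{H}$ denotes the complement of a graph $H$, and $|M|$ is the number of edges of the matching. -}

module Defs where

open import Data.Nat using (ℕ; _≤_; _+_; _∸_; _*_)
open import Data.Bool using (Bool; true; false; _∨_)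
open import Data.Fin using (Fin)
open import Data.Fin.Subset using (Subset; _∈_; _∉_; _∩_; ∣_∣)
open import Data.Fin.Properties using () renaming (_≟_ to _≟ᶠ_)
open import Data.Vec using (tabulate)
open import Data.List using (List; []; _∷_; _++_; length)
open import Data.List.Relation.Unary.All using (All)
open import Data.List.Relation.Unary.Unique.Propositional using (Unique)
open import Data.Product using (_×_; _,_; Σ; ∃; ∃-syntax; proj₁; proj₂)
open import Relation.Binary.PropositionalEquality using (_≡_; _≢_)
open import Relation.Nullary.Decidable using (⌊_⌋)
open import Function.Definitions using (Surjective)

record Graph (n : ℕ) : Set where
  field
    adj : Fin n → Fin n → Bool
    adj-sym : ∀ u v → adj u v ≡ adj v u
    adj-irrefl : ∀ v → adj v v ≡ false
open Graph public

data Reach {n : ℕ} (G : Graph n) : Fin n → Fin n → Set where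
  here : ∀ {v} → Reach G v v
  step : ∀ {u w v} → adj G u w ≡ true → Reach G w v → Reach G u v

Connected : ∀ {n} → Graph n → Set
Connected {n} G = (u v : Fin n) → Reach G u v

K : (n : ℕ) → Graph n
K n = record
  { adj = λ u v → Data.Bool.not ⌊ u ≟ᶠ v ⌋
  ; adj-sym = symK
  ; adj-irrefl = irrK }
  where
  open import Relation.Binary.PropositionalEquality using (refl; sym; cong)
  open import Relation.Nullary using (yes; no)
  symK : ∀ u v → Data.Bool.not ⌊ u ≟ᶠ v ⌋ ≡ Data.Bool.not ⌊ v ≟ᶠ u ⌋
  symK u v with u ≟ᶠ v | v ≟ᶠ u
  ... | yes _ | yes _ = refl
  ... | no _  | no _  = refl
  ... | yes p | no q  = Data.Empty.⊥-elim (q (sym p))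
    where import Data.Empty
  ... | no p  | yes q = Data.Empty.⊥-elim (p (sym q))
    where import Data.Empty
  irrK : ∀ v → Data.Bool.not ⌊ v ≟ᶠ v ⌋ ≡ false
  irrK v with v ≟ᶠ v
  ... | yes _ = refl
  ... | no p  = Data.Empty.⊥-elim (p refl)
    where import Data.Empty

Independent : ∀ {n} → Graph n → Subset n → Set
Independent {n} G I = ∀ (u v : Fin n) → u ∈ I → v ∈ I → adj G u v ≡ false

endpoints : ∀ {n} → List (Fin n × Fin n) → List (Fin n)
endpoints [] = []
endpoints ((u , v) ∷ es) = u ∷ v ∷ endpoints es

-- An edge of the complement of the induced subgraph G ∖ I
-- (i.e. of G[V(G) ∖ I]): distinct vertices outside I, non-adjacent in G.
EdgeOfComplMinus : ∀ {n} → Graph n → Subset n → Fin n × Fin n → Set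
EdgeOfComplMinus G I (u , v) = u ≢ v × u ∉ I × v ∉ I × adj G u v ≡ false

-- A matching in the complement of G ∖ I, as a list of edges whose
-- endpoints are pairwise distinct; |M| = length M.
IsMatchingComplMinus : ∀ {n} → Graph n → Subset n → List (Fin n × Fin n) → Set
IsMatchingComplMinus G I M = All (EdgeOfComplMinus G I) M × Unique (endpoints M)

closedNbhd : ∀ {n} → Graph n → Fin n → Subset n
closedNbhd G v = tabulate (λ u → ⌊ u ≟ᶠ v ⌋ ∨ adj G v u)

colourClass : ∀ {n k} → (Fin n → Fin k) → Fin k → Subset n
colourClass c i = tabulate (λ u → ⌊ c u ≟ᶠ i ⌋)

Proper : ∀ {n k} → Graph n → (Fin n → Fin k) → Set
Proper {n} G c = ∀ (u v : Fin n) → adj G u v ≡ true → c u ≢ c v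

MajorityDominating : ∀ {n k} → Graph n → (Fin n → Fin k) → Set
MajorityDominating {n} {k} G c =
  ∀ (v : Fin n) → ∃[ i ] ∣ colourClass c i ∣ ≤ 2 * ∣ closedNbhd G v ∩ colourClass c i ∣

-- G has a majority dominator colouring with exactly k (nonempty) colour
-- classes: c is surjective onto Fin k.
HasMDC : ∀ {n} → Graph n → ℕ → Set
HasMDC {n} G k =
  Σ (Fin n → Fin k) λ c → Surjective _≡_ _≡_ c × Proper G c × MajorityDominating G c

IsChiMd : ∀ {n} → Graph n → ℕ → Set
IsChiMd G k = HasMDC G k × (∀ j → HasMDC G j → k ≤ j)

bound : ∀ {n} → List (Fin n × Fin n) → Subset n → ℕ
bound {n} M I = (n ∸ length M ∸ ∣ I ∣) + 1

-- Colour every edge of M with its own colour, all of I with one more colour,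
-- and every remaining vertex with a colour of its own: this uses at most
-- n − |M| − |I| + 1 colours. The colouring is proper because matched pairs are
-- non-adjacent in G and I is independent. It is majority dominating because
-- every closed neighbourhood N[v] contains a vertex w outside I (v itself, or
-- by connectivity a neighbour of v), and the colour class of w has at most two
-- vertices, at least one of them in N[v]. For K_n with |I| = 1 and M empty the
-- bound is n, and K_n needs n colours. Whether a majority dominator colouring
-- with k colours exists is decided by exhaustive search, so χ_md exists as the
-- least such k.
module Submission where

open import Defs
open import Data.Bool using (Bool; true; false; _∨_)
open import Data.Bool.Properties using (∨-zeroʳ; T-≡) renaming (_≟_ to _≟ᵇ_)
open import Data.Empty using (⊥-elim)
open import Data.Fin using (Fin; zero; suc; toℕ; fromℕ; fromℕ<; inject; punchIn; punchOut)
open import Data.Fin.Properties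
  using (_≟_; ¬Fin0; any?; all?; ¬∀⟶∃¬-smallest; toℕ-fromℕ; toℕ-fromℕ<; toℕ-inject;
         punchInᵢ≢i; punchOut-cong; punchOut-punchIn; punchOut-injective; injective⇒≤)
open import Data.Fin.Subset using (Subset; _∈_; _∉_; _∩_; _-_; ∣_∣; ⁅_⁆; _⊆_; inside; outside)
open import Data.Fin.Subset.Properties
  using (_∈?_; nonempty?; Empty-unique; ∣⊥∣≡0; p─⊥≡p; p─q⊆p; p⊆q⇒∣p∣≤∣q∣; x∈⁅x⁆; x∈⁅y⁆⇒x≡y;
         ∣⁅x⁆∣≡1; x∈p∩q⁺)
open import Data.List using (List; []; _∷_; length)
open import Data.List.Membership.Propositional using () renaming (_∈_ to _∈ₗ_)
open import Data.List.Relation.Unary.Any using (here; there)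
open import Data.List.Relation.Unary.All as All using (All; []; _∷_)
open import Data.List.Relation.Unary.All.Properties using (All¬⇒¬Any)
open import Data.List.Relation.Unary.AllPairs using ([]; _∷_)
open import Data.List.Relation.Unary.Unique.Propositional using (Unique)
open import Data.Nat using (ℕ; suc; _+_; _∸_; _*_; _≤_; _≤?_; s≤s; z≤n)
open import Data.Nat.Properties
  using (≤-trans; m≤m+n; ≤-antisym; ≤-reflexive; ≮⇒≥; +-identityʳ; +-suc; +-comm; +-assoc;
         +-cancelˡ-≤; +-monoˡ-≤; *-monoʳ-≤; m≤n+m∸n; ∸-+-assoc; module ≤-Reasoning)
open import Data.Nat.Tactic.RingSolver using (solve-∀)
open import Data.Product using (_×_; _,_; Σ; ∃; ∃-syntax; proj₁; proj₂)
open import Data.Sum as Sum using (_⊎_; inj₁; inj₂)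
import Data.Vec.Functional as Vector
open import Data.Vec.Properties using (lookup⇒[]=; []=⇒lookup; lookup∘tabulate; tabulate-cong)
open import Data.Vec using (tabulate; _∷_; here; there)
open import Function using (_∘_; id; _on_; Equivalence)
open import Function.Definitions using (Surjective; StrictlySurjective)
open import Function.Consequences.Propositional
  using (strictlySurjective⇒surjective; surjective⇒strictlySurjective)
open import Level using (0ℓ)
open import Relation.Binary using (Rel; _⇒_)
open import Relation.Binary.Construct.Union using (_∪_)
open import Relation.Binary.PropositionalEquality
  using (_≡_; _≢_; _≗_; refl; sym; trans; cong; subst)
open import Relation.Nullary using (¬_; Dec; yes; no; ¬?; contradiction)
open import Relation.Nullary.Decidable
  using (⌊_⌋; map′; _×-dec_; _→-dec_; fromWitness; toWitness; decidable-stable)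

private
  variable
    n k : ℕ

x∉p-x : (p : Subset n) (x : Fin n) → x ∉ p - x
x∉p-x (_ ∷ p) (suc x) (there x∈p-x) = x∉p-x p x x∈p-x

∈p-x⇒≢ : {p : Subset n} {x y : Fin n} → y ∈ p - x → y ≢ x
∈p-x⇒≢ {p = p} y∈p-x refl = x∉p-x p _ y∈p-x

∣p∣≡1+∣p-x∣ : {p : Subset n} {x : Fin n} → x ∈ p → ∣ p ∣ ≡ suc ∣ p - x ∣
∣p∣≡1+∣p-x∣ {p = inside ∷ p} here = cong (suc ∘ ∣_∣) (sym (p─⊥≡p p))
∣p∣≡1+∣p-x∣ {p = inside ∷ p} (there x∈p) = cong suc (∣p∣≡1+∣p-x∣ x∈p)
∣p∣≡1+∣p-x∣ {p = outside ∷ p} (there x∈p) = ∣p∣≡1+∣p-x∣ x∈p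

x∈p⇒1≤∣p∣ : {p : Subset n} {x : Fin n} → x ∈ p → 1 ≤ ∣ p ∣
x∈p⇒1≤∣p∣ x∈p = subst (1 ≤_) (sym (∣p∣≡1+∣p-x∣ x∈p)) (s≤s z≤n)

∈-tabulate⁺ : {f : Fin n → Bool} {x : Fin n} → f x ≡ true → x ∈ tabulate f
∈-tabulate⁺ {f = f} {x} fx = lookup⇒[]= x (tabulate f) (trans (lookup∘tabulate f x) fx)

∈-tabulate⁻ : {f : Fin n → Bool} {x : Fin n} → x ∈ tabulate f → f x ≡ true
∈-tabulate⁻ {f = f} {x} x∈ = trans (sym (lookup∘tabulate f x)) ([]=⇒lookup x∈)

∈-colourClass⁺ : {c : Fin n → Fin k} {u : Fin n} {i : Fin k} → c u ≡ i → u ∈ colourClass c i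
∈-colourClass⁺ cu≡i = ∈-tabulate⁺ (Equivalence.to T-≡ (fromWitness cu≡i))

∈-colourClass⁻ : {c : Fin n → Fin k} {u : Fin n} {i : Fin k} → u ∈ colourClass c i → c u ≡ i
∈-colourClass⁻ u∈ = toWitness (Equivalence.from T-≡ (∈-tabulate⁻ u∈))

_∈[_,_] : {A : Set} → A → A → A → Set
x ∈[ a , b ] = x ≡ a ⊎ x ≡ b

module _ {i j : Fin (suc k)} (i≢j : i ≢ j) where

  identify : Fin (suc k) → Fin k
  identify y with i ≟ y
  ... | yes _   = punchOut i≢j
  ... | no  i≢y = punchOut i≢y

  identify-punchIn : ∀ t → identify (punchIn i t) ≡ t
  identify-punchIn t with i ≟ punchIn i t
  ... | yes i≡ = ⊥-elim (punchInᵢ≢i i t (sym i≡))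
  ... | no  _  = trans (punchOut-cong i refl) (punchOut-punchIn i)

  identify-kernel : ∀ {y z} → identify y ≡ identify z → y ≡ z ⊎ (y ∈[ i , j ] × z ∈[ i , j ])
  identify-kernel {y} {z} eq with i ≟ y | i ≟ z
  ... | yes i≡y | yes i≡z = inj₁ (trans (sym i≡y) i≡z)
  ... | yes i≡y | no  i≢z = inj₂ (inj₁ (sym i≡y) , inj₂ (sym (punchOut-injective i≢j i≢z eq)))
  ... | no  i≢y | yes i≡z = inj₂ (inj₂ (punchOut-injective i≢y i≢j eq) , inj₁ (sym i≡z))
  ... | no  i≢y | no  i≢z = inj₁ (punchOut-injective i≢y i≢z eq)

-- Merging colour classes

ColouringWithin : Rel (Fin n) 0ℓ → ℕ → Set
ColouringWithin {n} R k = Σ (Fin n → Fin k) λ c → StrictlySurjective _≡_ c × (_≡_ on c) ⇒ R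

relax : {R R′ : Rel (Fin n) 0ℓ} → R ⇒ R′ → ColouringWithin R k → ColouringWithin R′ k
relax R⇒R′ (c , surj , ker) = c , surj , λ eq → R⇒R′ (ker eq)

Fused : Rel (Fin n) 0ℓ → Fin n → Fin n → Rel (Fin n) 0ℓ
Fused R a b u v = R u v ⊎ ((R u a ⊎ R u b) × (R v a ⊎ R v b))

merge : {R : Rel (Fin n) 0ℓ} {a b : Fin n} → ¬ R a b →
        ColouringWithin R (suc k) → ColouringWithin (Fused R a b) k
merge {R = R} {a} {b} ¬Rab (c , surj , ker) = identify ca≢cb ∘ c , surj′ , ker′
  where
  ca≢cb : c a ≢ c b
  ca≢cb eq = ¬Rab (ker eq)

  surj′ : StrictlySurjective _≡_ (identify ca≢cb ∘ c)
  surj′ t with surj (punchIn (c a) t)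
  ... | x , cx≡ = x , trans (cong (identify ca≢cb) cx≡) (identify-punchIn ca≢cb t)

  ker′ : (_≡_ on (identify ca≢cb ∘ c)) ⇒ Fused R a b
  ker′ eq with identify-kernel ca≢cb eq
  ... | inj₁ same       = inj₁ (ker same)
  ... | inj₂ (u∈ , v∈) = inj₂ (Sum.map ker ker u∈ , Sum.map ker ker v∈)

Isolated : Rel (Fin n) 0ℓ → Fin n → Set
Isolated R x = ∀ {y} → R x y ⊎ R y x → x ≡ y

Attached : Rel (Fin n) 0ℓ → Subset n → Fin n → Fin n → Set
Attached R S r x = x ∈ S ⊎ R x r

FusedInto : Rel (Fin n) 0ℓ → Subset n → Fin n → Rel (Fin n) 0ℓ
FusedInto R S r u v = R u v ⊎ (Attached R S r u × Attached R S r v)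

module FuseStep {R : Rel (Fin n) 0ℓ} {S : Subset n} {r x : Fin n}
                (r∉S : r ∉ S) (iso : ∀ {y} → y ∈ S → Isolated R y) (x∈S : x ∈ S) where

  ¬Rxr : ¬ R x r
  ¬Rxr Rxr = r∉S (subst (_∈ S) (iso x∈S (inj₁ Rxr)) x∈S)

  r∉S-x : r ∉ S - x
  r∉S-x r∈ = r∉S (p─q⊆p S ⁅ x ⁆ r∈)

  isolated : ∀ {y} → y ∈ S - x → Isolated (Fused R x r) y
  isolated {y} y∈ = iso y∈S ∘ Sum.map unfused unfused′
    where
    y∈S : y ∈ S
    y∈S = p─q⊆p S ⁅ x ⁆ y∈
    ¬near : ¬ (R y x ⊎ R y r)
    ¬near (inj₁ Ryx) = ∈p-x⇒≢ y∈ (iso y∈S (inj₁ Ryx))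
    ¬near (inj₂ Ryr) = r∉S (subst (_∈ S) (iso y∈S (inj₁ Ryr)) y∈S)
    unfused : ∀ {z} → Fused R x r y z → R y z
    unfused = Sum.[ id , ⊥-elim ∘ ¬near ∘ proj₁ ]
    unfused′ : ∀ {z} → Fused R x r z y → R z y
    unfused′ = Sum.[ id , ⊥-elim ∘ ¬near ∘ proj₂ ]

  near⇒attached : ∀ {u} → R u x ⊎ R u r → Attached R S r u
  near⇒attached (inj₁ Rux) = inj₁ (subst (_∈ S) (iso x∈S (inj₂ Rux)) x∈S)
  near⇒attached (inj₂ Rur) = inj₂ Rur

  attached : ∀ {u} → Attached (Fused R x r) (S - x) r u → Attached R S r u
  attached (inj₁ u∈) = inj₁ (p─q⊆p S ⁅ x ⁆ u∈)
  attached (inj₂ (inj₁ Rur)) = inj₂ Rur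
  attached (inj₂ (inj₂ (near , _))) = near⇒attached near

  fusedInto⇒ : FusedInto (Fused R x r) (S - x) r ⇒ FusedInto R S r
  fusedInto⇒ (inj₁ (inj₁ Ruv)) = inj₁ Ruv
  fusedInto⇒ (inj₁ (inj₂ (nu , nv))) = inj₂ (near⇒attached nu , near⇒attached nv)
  fusedInto⇒ (inj₂ (au , av)) = inj₂ (attached au , attached av)

-- Isolation makes every member of S a singleton class, so each step really removes a colour.
mergeInto : {R : Rel (Fin n) 0ℓ} (S : Subset n) {r : Fin n} → r ∉ S →
            (∀ {x} → x ∈ S → Isolated R x) → ColouringWithin R k →
            Σ ℕ λ k′ → k′ + ∣ S ∣ ≡ k × ColouringWithin (FusedInto R S r) k′
mergeInto {k = 0} S {r} _ _ (c , _) = ⊥-elim (¬Fin0 (c r))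
mergeInto {n} {suc k} S r∉S iso col with nonempty? S
... | no ∅ = suc k , trans (cong (suc k +_) ∣S∣≡0) (+-identityʳ (suc k)) , relax inj₁ col
  where
  ∣S∣≡0 : ∣ S ∣ ≡ 0
  ∣S∣≡0 = trans (cong ∣_∣ (Empty-unique ∅)) (∣⊥∣≡0 n)
... | yes (x , x∈S) =
  let k′ , k′+∣S-x∣≡k , col′ = mergeInto (S - x) r∉S-x isolated (merge ¬Rxr col)
  in k′ , trans (cong (k′ +_) (∣p∣≡1+∣p-x∣ x∈S)) (trans (+-suc k′ _) (cong suc k′+∣S-x∣≡k))
     , relax fusedInto⇒ col′
  where open FuseStep r∉S iso x∈S

-- Matchings

Partners : List (Fin n × Fin n) → Rel (Fin n) 0ℓ
Partners M u v = (u , v) ∈ₗ M ⊎ (v , u) ∈ₗ M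

Paired : List (Fin n × Fin n) → Rel (Fin n) 0ℓ
Paired M = _≡_ ∪ Partners M

∈⇒∈-endpoints : {M : List (Fin n × Fin n)} {u v : Fin n} →
                (u , v) ∈ₗ M → u ∈ₗ endpoints M × v ∈ₗ endpoints M
∈⇒∈-endpoints {M = _ ∷ _} (here refl) = here refl , there (here refl)
∈⇒∈-endpoints {M = _ ∷ _} (there uv∈M) =
  let u∈ , v∈ = ∈⇒∈-endpoints uv∈M in there (there u∈) , there (there v∈)

Partners⇒∈-endpoints : {M : List (Fin n × Fin n)} {u v : Fin n} →
                       Partners M u v → u ∈ₗ endpoints M
Partners⇒∈-endpoints (inj₁ uv∈M) = proj₁ (∈⇒∈-endpoints uv∈M)
Partners⇒∈-endpoints (inj₂ vu∈M) = proj₂ (∈⇒∈-endpoints vu∈M)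

Partners⇒≢ : {M : List (Fin n × Fin n)} {a y w : Fin n} →
             All (a ≢_) (endpoints M) → Partners M y w → w ≢ a
Partners⇒≢ a∉ p refl = All¬⇒¬Any a∉ (Partners⇒∈-endpoints (Sum.swap p))

Paired-unmatched : {M : List (Fin n × Fin n)} {a u : Fin n} →
                   All (a ≢_) (endpoints M) → Paired M u a → u ≡ a
Paired-unmatched a∉ (inj₁ u≡a) = u≡a
Paired-unmatched a∉ (inj₂ p) = ⊥-elim (Partners⇒≢ a∉ p refl)

pairingColouring : (M : List (Fin n × Fin n)) → Unique (endpoints M) →
                   Σ ℕ λ k → k + length M ≡ n × ColouringWithin (Paired M) k
pairingColouring {n} [] _ = n , +-identityʳ n , id , (λ y → y , refl) , inj₁
pairingColouring {n} ((a , b) ∷ M) ((a≢b ∷ a∉) ∷ b∉ ∷ uq) = addEdge (pairingColouring M uq)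
  where
  ¬Pab : ¬ Paired M a b
  ¬Pab (inj₁ a≡b) = a≢b a≡b
  ¬Pab (inj₂ p) = Partners⇒≢ a∉ (Sum.swap p) refl

  paired-ends : ∀ {u v} → u ∈[ a , b ] → v ∈[ a , b ] → Paired ((a , b) ∷ M) u v
  paired-ends (inj₁ refl) (inj₁ refl) = inj₁ refl
  paired-ends (inj₁ refl) (inj₂ refl) = inj₂ (inj₁ (here refl))
  paired-ends (inj₂ refl) (inj₁ refl) = inj₂ (inj₂ (here refl))
  paired-ends (inj₂ refl) (inj₂ refl) = inj₁ refl

  near : ∀ {u} → Paired M u a ⊎ Paired M u b → u ∈[ a , b ]
  near = Sum.map (Paired-unmatched a∉) (Paired-unmatched b∉)

  fused⇒ : Fused (Paired M) a b ⇒ Paired ((a , b) ∷ M)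
  fused⇒ (inj₁ (inj₁ u≡v)) = inj₁ u≡v
  fused⇒ (inj₁ (inj₂ p)) = inj₂ (Sum.map there there p)
  fused⇒ (inj₂ (nu , nv)) = paired-ends (near nu) (near nv)

  addEdge : Σ ℕ (λ k → k + length M ≡ n × ColouringWithin (Paired M) k) →
            Σ ℕ (λ k → k + suc (length M) ≡ n × ColouringWithin (Paired ((a , b) ∷ M)) k)
  addEdge (0 , _ , c , _) = ⊥-elim (¬Fin0 (c a))
  addEdge (suc k , count , col) = k , trans (+-suc k _) count , relax fused⇒ (merge ¬Pab col)

-- An unmatched vertex is its own partner.
partner : List (Fin n × Fin n) → Fin n → Fin n
partner [] w = w
partner ((a , b) ∷ M) w with w ≟ a | w ≟ b
... | yes _ | _     = b
... | no _  | yes _ = a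
... | no _  | no _  = partner M w

partner-∷ : {M : List (Fin n × Fin n)} {a b w : Fin n} → w ≢ a → w ≢ b →
            partner ((a , b) ∷ M) w ≡ partner M w
partner-∷ {a = a} {b} {w} w≢a w≢b with w ≟ a | w ≟ b
... | yes w≡a | _       = ⊥-elim (w≢a w≡a)
... | no _    | yes w≡b = ⊥-elim (w≢b w≡b)
... | no _    | no _    = refl

partner-unique : {M : List (Fin n × Fin n)} → Unique (endpoints M) →
                 ∀ {y w} → Partners M y w → y ≡ partner M w
partner-unique {M = (a , b) ∷ _} _ (inj₁ (here refl)) with b ≟ a | b ≟ b
... | yes b≡a | _      = sym b≡a
... | no _    | yes _  = refl
... | no _    | no b≢b = ⊥-elim (b≢b refl)
partner-unique {M = (a , _) ∷ _} _ (inj₂ (here refl)) with a ≟ a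
... | yes _   = refl
... | no a≢a = ⊥-elim (a≢a refl)
partner-unique ((_ ∷ a∉) ∷ b∉ ∷ uq) (inj₁ (there yw∈M)) =
  let p = inj₁ yw∈M in trans (partner-unique uq p) (sym (partner-∷ (Partners⇒≢ a∉ p) (Partners⇒≢ b∉ p)))
partner-unique ((_ ∷ a∉) ∷ b∉ ∷ uq) (inj₂ (there wy∈M)) =
  let p = inj₂ wy∈M in trans (partner-unique uq p) (sym (partner-∷ (Partners⇒≢ a∉ p) (Partners⇒≢ b∉ p)))

Grouped : List (Fin n × Fin n) → Subset n → Rel (Fin n) 0ℓ
Grouped M I u v = Paired M u v ⊎ (u ∈ I × v ∈ I)

module _ {G : Graph n} {I : Subset n} {M : List (Fin n × Fin n)}
         (edges : All (EdgeOfComplMinus G I) M) where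

  Partners⇒∉ : ∀ {u v} → Partners M u v → u ∉ I
  Partners⇒∉ (inj₁ uv∈M) = proj₁ (proj₂ (All.lookup edges uv∈M))
  Partners⇒∉ (inj₂ vu∈M) = proj₁ (proj₂ (proj₂ (All.lookup edges vu∈M)))

  Partners⇒nonadjacent : ∀ {u v} → Partners M u v → adj G u v ≡ false
  Partners⇒nonadjacent (inj₁ uv∈M) = proj₂ (proj₂ (proj₂ (All.lookup edges uv∈M)))
  Partners⇒nonadjacent {u} {v} (inj₂ vu∈M) =
    trans (adj-sym G u v) (proj₂ (proj₂ (proj₂ (All.lookup edges vu∈M))))

  Grouped⇒nonadjacent : Independent G I → ∀ {u v} → Grouped M I u v → adj G u v ≡ false
  Grouped⇒nonadjacent _   {u} (inj₁ (inj₁ refl)) = adj-irrefl G u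
  Grouped⇒nonadjacent _   (inj₁ (inj₂ p)) = Partners⇒nonadjacent p
  Grouped⇒nonadjacent ind {u} {v} (inj₂ (u∈I , v∈I)) = ind u v u∈I v∈I

  Paired-isolated : ∀ {x} → x ∈ I → Isolated (Paired M) x
  Paired-isolated _   (inj₁ (inj₁ x≡y)) = x≡y
  Paired-isolated x∈I (inj₁ (inj₂ p)) = ⊥-elim (Partners⇒∉ p x∈I)
  Paired-isolated _   (inj₂ (inj₁ y≡x)) = sym y≡x
  Paired-isolated x∈I (inj₂ (inj₂ p)) = ⊥-elim (Partners⇒∉ (Sum.swap p) x∈I)

  FusedInto⇒Grouped : ∀ {r} → r ∈ I → FusedInto (Paired M) (I - r) r ⇒ Grouped M I
  FusedInto⇒Grouped r∈I (inj₁ p) = inj₁ p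
  FusedInto⇒Grouped r∈I (inj₂ (au , av)) = inj₂ (attached au , attached av)
    where
    attached : ∀ {u} → Attached (Paired M) (I - _) _ u → u ∈ I
    attached (inj₁ u∈) = p─q⊆p _ _ u∈
    attached (inj₂ (inj₁ refl)) = r∈I
    attached (inj₂ (inj₂ p)) = ⊥-elim (Partners⇒∉ (Sum.swap p) r∈I)

private
  rearrange : ∀ a b c → a + (b + suc c) ≡ a + c + b + 1
  rearrange = solve-∀

  recount : ∀ k′ c m {k n} → k′ + c ≡ k → k + m ≡ n → k′ + (m + suc c) ≡ n + 1
  recount k′ c m refl refl = rearrange k′ m c

groupedColouring : {G : Graph n} {I : Subset n} {M : List (Fin n × Fin n)} →
                   IsMatchingComplMinus G I M →
                   Σ ℕ λ k → k + (length M + ∣ I ∣) ≤ n + 1 × ColouringWithin (Grouped M I) k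
groupedColouring {n} {G} {I} {M} (edges , uq) with pairingColouring M uq | nonempty? I
... | k , k+∣M∣≡n , col | no ∅ = k , count , relax inj₁ col
  where
  count : k + (length M + ∣ I ∣) ≤ n + 1
  count rewrite Empty-unique ∅ | ∣⊥∣≡0 n | +-identityʳ (length M) | k+∣M∣≡n = m≤m+n n 1
... | k , k+∣M∣≡n , col | yes (r , r∈I) =
  let k′ , k′+∣I-r∣≡k , col′ =
        mergeInto (I - r) (x∉p-x I r) (λ x∈ → Paired-isolated {G = G} edges (p─q⊆p I ⁅ r ⁆ x∈)) col
  in k′
     , ≤-reflexive (trans (cong (λ i → k′ + (length M + i)) (∣p∣≡1+∣p-x∣ r∈I))
                          (recount k′ _ (length M) k′+∣I-r∣≡k k+∣M∣≡n))
     , relax (FusedInto⇒Grouped {G = G} edges r∈I) col′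

colourClass≤2 : {I : Subset n} {M : List (Fin n × Fin n)} {c : Fin n → Fin k} →
                Unique (endpoints M) → (_≡_ on c) ⇒ Grouped M I →
                ∀ {w} → w ∉ I → ∣ colourClass c (c w) ∣ ≤ 2
colourClass≤2 {M = M} {c} uq ker {w} w∉I = begin
  ∣ C ∣                      ≡⟨ ∣p∣≡1+∣p-x∣ (∈-colourClass⁺ {c = c} {w} refl) ⟩
  suc ∣ C - w ∣              ≤⟨ s≤s (p⊆q⇒∣p∣≤∣q∣ C-w⊆partner) ⟩
  suc ∣ ⁅ partner M w ⁆ ∣    ≡⟨ cong suc (∣⁅x⁆∣≡1 (partner M w)) ⟩
  2                          ∎
  where
  open ≤-Reasoning
  C : Subset _
  C = colourClass c (c w)
  C-w⊆partner : C - w ⊆ ⁅ partner M w ⁆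
  C-w⊆partner {y} y∈ with ker (∈-colourClass⁻ (p─q⊆p C ⁅ w ⁆ y∈))
  ... | inj₁ (inj₁ y≡w) = ⊥-elim (∈p-x⇒≢ y∈ y≡w)
  ... | inj₁ (inj₂ p)   = subst (_∈ ⁅ partner M w ⁆) (sym (partner-unique uq p)) (x∈⁅x⁆ _)
  ... | inj₂ (_ , w∈I)  = ⊥-elim (w∉I w∈I)

anotherVertex : 2 ≤ n → (v : Fin n) → ∃[ u ] u ≢ v
anotherVertex (s≤s (s≤s _)) zero    = suc zero , λ ()
anotherVertex (s≤s (s≤s _)) (suc _) = zero , λ ()

Reach⇒neighbour : {G : Graph n} {v u : Fin n} → Reach G v u → u ≢ v → ∃[ w ] adj G v w ≡ true
Reach⇒neighbour here       u≢v = ⊥-elim (u≢v refl)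
Reach⇒neighbour (step vw _) _  = _ , vw

∈closedNbhd-self : (G : Graph n) (v : Fin n) → v ∈ closedNbhd G v
∈closedNbhd-self G v = ∈-tabulate⁺ (cong (_∨ adj G v v) (Equivalence.to T-≡ (fromWitness {a? = v ≟ v} refl)))

adj⇒∈closedNbhd : (G : Graph n) {v w : Fin n} → adj G v w ≡ true → w ∈ closedNbhd G v
adj⇒∈closedNbhd G {v} {w} vw = ∈-tabulate⁺ (trans (cong (⌊ w ≟ v ⌋ ∨_) vw) (∨-zeroʳ _))

closedNbhd⊈I : {G : Graph n} {I : Subset n} → 2 ≤ n → Connected G → Independent G I →
               ∀ v → ∃[ w ] (w ∈ closedNbhd G v × w ∉ I)
closedNbhd⊈I {G = G} {I} 2≤n conn ind v with v ∈? I
... | no v∉I  = v , ∈closedNbhd-self G v , v∉I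
... | yes v∈I =
  let u , u≢v = anotherVertex 2≤n v
      w , vw  = Reach⇒neighbour (conn v u) u≢v
  in w , adj⇒∈closedNbhd G vw , λ w∈I → contradiction (trans (sym vw) (ind v w v∈I w∈I)) λ ()

groupedColouring⇒HasMDC : {G : Graph n} {I : Subset n} {M : List (Fin n × Fin n)} →
                          2 ≤ n → Connected G → Independent G I → IsMatchingComplMinus G I M →
                          ColouringWithin (Grouped M I) k → HasMDC G k
groupedColouring⇒HasMDC {G = G} 2≤n conn ind (edges , uq) (c , surj , ker) =
  c , strictlySurjective⇒surjective surj , proper , majority
  where
  proper : Proper G c
  proper u v uv cu≡cv = contradiction (trans (sym uv) (Grouped⇒nonadjacent {G = G} edges ind (ker cu≡cv))) λ ()

  majority : MajorityDominating G c
  majority v =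
    let w , w∈N[v] , w∉I = closedNbhd⊈I 2≤n conn ind v
    in c w , ≤-trans (colourClass≤2 uq ker w∉I)
                     (*-monoʳ-≤ 2 (x∈p⇒1≤∣p∣ (x∈p∩q⁺ (w∈N[v] , ∈-colourClass⁺ refl))))

-- Existence of χ_md

anyFunction? : (P : (Fin n → Fin k) → Set) → (∀ {f g} → f ≗ g → P f → P g) →
               (∀ f → Dec (P f)) → Dec (∃ P)
anyFunction? {0} P resp P? = map′ (λ p → _ , p) (λ (f , p) → resp (λ ()) p) (P? λ ())
anyFunction? {suc n} P resp P? =
  map′ (λ (a , f , p) → a Vector.∷ f , p)
       (λ (f , p) → f zero , f ∘ suc , resp (λ { zero → refl ; (suc i) → refl }) p)
       (any? λ a → anyFunction? (P ∘ (a Vector.∷_))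
                                (λ f≗g → resp (λ { zero → refl ; (suc i) → f≗g i }))
                                (P? ∘ (a Vector.∷_)))

hasMDC? : (G : Graph n) (k : ℕ) → Dec (HasMDC G k)
hasMDC? {n} G k = anyFunction? _ resp λ c → surjective? c ×-dec proper? c ×-dec majority? c
  where
  surjective? : (c : Fin n → Fin k) → Dec (Surjective _≡_ _≡_ c)
  surjective? c = map′ strictlySurjective⇒surjective surjective⇒strictlySurjective
                       (all? λ y → any? λ x → c x ≟ y)

  proper? : (c : Fin n → Fin k) → Dec (Proper G c)
  proper? c = all? λ u → all? λ v → (adj G u v ≟ᵇ true) →-dec ¬? (c u ≟ c v)

  majority? : (c : Fin n → Fin k) → Dec (MajorityDominating G c)
  majority? c = all? λ v → any? λ i →
    ∣ colourClass c i ∣ ≤? 2 * ∣ closedNbhd G v ∩ colourClass c i ∣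

  resp : ∀ {f g} → f ≗ g →
         Surjective _≡_ _≡_ f × Proper G f × MajorityDominating G f →
         Surjective _≡_ _≡_ g × Proper G g × MajorityDominating G g
  resp {f} {g} f≗g (surj , proper , majority) = surj′ , proper′ , majority′
    where
    surj′ : Surjective _≡_ _≡_ g
    surj′ y = let x , fx≡y = surj y in x , λ z≡x → trans (sym (f≗g _)) (fx≡y z≡x)
    proper′ : Proper G g
    proper′ u v uv gu≡gv = proper u v uv (trans (f≗g u) (trans gu≡gv (sym (f≗g v))))
    majority′ : MajorityDominating G g
    majority′ v =
      let i , large = majority v
      in i , subst (λ C → ∣ C ∣ ≤ 2 * ∣ closedNbhd G v ∩ C ∣)
                   (tabulate-cong λ u → cong (λ t → ⌊ t ≟ i ⌋) (f≗g u)) large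

minimum : {P : ℕ → Set} → (∀ k → Dec (P k)) → ∀ {m} → P m → ∃[ k ] (P k × ∀ j → P j → k ≤ j)
minimum {P} P? {m} Pm =
  let i , ¬¬Pi , below = ¬∀⟶∃¬-smallest (suc m) (¬_ ∘ P ∘ toℕ) (¬? ∘ P? ∘ toℕ)
                           (λ ¬P → ¬P (fromℕ m) (subst P (sym (toℕ-fromℕ m)) Pm))
  in toℕ i , decidable-stable (P? (toℕ i)) ¬¬Pi
     , λ j Pj → ≮⇒≥ λ j<i → below (fromℕ< j<i)
                               (subst P (sym (trans (toℕ-inject (fromℕ< j<i)) (toℕ-fromℕ< j<i))) Pj)

χmd≤ : (G : Graph n) → HasMDC G k → ∃[ χ ] (IsChiMd G χ × χ ≤ k)
χmd≤ {k = k} G hasMDC =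
  let χ , isχ , least = minimum (hasMDC? G) hasMDC in χ , (isχ , least) , least k hasMDC

m+n≤o+1⇒m≤o∸n+1 : ∀ {m n o} → m + n ≤ o + 1 → m ≤ o ∸ n + 1
m+n≤o+1⇒m≤o∸n+1 {m} {n} {o} m+n≤o+1 = +-cancelˡ-≤ n m (o ∸ n + 1) (begin
  n + m           ≡⟨ +-comm n m ⟩
  m + n           ≤⟨ m+n≤o+1 ⟩
  o + 1           ≤⟨ +-monoˡ-≤ 1 (m≤n+m∸n o n) ⟩
  n + (o ∸ n) + 1 ≡⟨ +-assoc n (o ∸ n) 1 ⟩
  n + (o ∸ n + 1) ∎)
  where open ≤-Reasoning

χmd≤bound : (n : ℕ) → 2 ≤ n → (G : Graph n) → Connected G →
            (I : Subset n) → Independent G I →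
            (M : List (Fin n × Fin n)) → IsMatchingComplMinus G I M →
            ∃[ k ] (IsChiMd G k × k ≤ bound M I)
χmd≤bound n 2≤n G conn I ind M matching =
  let k , size , col = groupedColouring {G = G} matching
      χ , isχ , χ≤k  = χmd≤ G (groupedColouring⇒HasMDC 2≤n conn ind matching col)
  in χ , isχ , ≤-trans χ≤k (subst (λ t → k ≤ t + 1) (sym (∸-+-assoc n (length M) ∣ I ∣))
                                  (m+n≤o+1⇒m≤o∸n+1 size))

-- Sharpness on complete graphs

K-adjacent : {u v : Fin n} → u ≢ v → adj (K n) u v ≡ true
K-adjacent {u = u} {v} u≢v with u ≟ v
... | yes u≡v = ⊥-elim (u≢v u≡v)
... | no _    = refl

K-connected : Connected (K n)
K-connected u v with u ≟ v
... | yes refl = here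
... | no u≢v   = step (K-adjacent u≢v) here

HasMDC-K⇒n≤ : ∀ {j} → HasMDC (K n) j → n ≤ j
HasMDC-K⇒n≤ (c , _ , proper , _) = injective⇒≤ injective
  where
  injective : ∀ {u v} → c u ≡ c v → u ≡ v
  injective {u} {v} cu≡cv with u ≟ v
  ... | yes u≡v = u≡v
  ... | no u≢v  = ⊥-elim (proper u v (K-adjacent u≢v) cu≡cv)

χmd-K≡bound : (n : ℕ) → 2 ≤ n →
              Σ (Subset n) λ I → Σ (List (Fin n × Fin n)) λ M →
                Independent (K n) I × IsMatchingComplMinus (K n) I M ×
                ∃[ k ] (IsChiMd (K n) k × k ≡ bound M I)
χmd-K≡bound (suc n) 2≤n =
  let χ , isχ , χ≤bound = χmd≤bound (suc n) 2≤n (K (suc n)) K-connected ⁅ zero ⁆ independent [] ([] , [])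
  in ⁅ zero ⁆ , [] , independent , ([] , []) , χ , isχ
     , ≤-antisym χ≤bound (subst (_≤ χ) (sym bound≡) (HasMDC-K⇒n≤ (proj₁ isχ)))
  where
  independent : Independent (K (suc n)) ⁅ zero ⁆
  independent u v u∈ v∈ rewrite x∈⁅y⁆⇒x≡y zero u∈ | x∈⁅y⁆⇒x≡y zero v∈ = adj-irrefl (K (suc n)) zero
  bound≡ : bound {suc n} [] ⁅ zero ⁆ ≡ suc n
  bound≡ = trans (cong (λ i → suc n ∸ i + 1) (∣⁅x⁆∣≡1 (zero {n}))) (+-comm n 1)

theorem2p2 :
    ((n : ℕ) → 2 ≤ n → (G : Graph n) → Connected G →
      (I : Subset n) → Independent G I →
      (M : List (Fin n × Fin n)) → IsMatchingComplMinus G I M →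
      ∃[ k ] (IsChiMd G k × k ≤ bound M I))
    ×
    ((n : ℕ) → 2 ≤ n →
      Σ (Subset n) λ I → Σ (List (Fin n × Fin n)) λ M →
        Independent (K n) I × IsMatchingComplMinus (K n) I M ×
        ∃[ k ] (IsChiMd (K n) k × k ≡ bound M I))
theorem2p2 = χmd≤bound , χmd-K≡bound
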